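{- Let $G$ be a sunlike graph of order $n$ with girth $g$ having exactly $k\geq 1$ $p$-dominators on its cycle $\mathbb{C}=v_1v_2\cdots v_gv_1$. Let $G^{\ast}$ be a sunlike graph of order $n$ with girth $g$ whose $p$-dominators on $\mathbb{C}$ are exactly the $k$ consecutive vertices $v_1,v_2,\ldots,v_k$. Then $\gamma(G)\leq\gamma(G^{\ast})$, where $\gamma(G^{\ast})=k+\left\lceil\frac{g-k-2}{3}\right\rceil$.
   Context: All graphs are simple and connected. $\gamma$ denotes the domination number (minimum size of a vertex set $D$ such that every vertex outside $D$ is adjacent to a vertex of $D$). A vertex is a $p$-dominator if it is adjacent to a pendant vertex (a vertex of degree 1). A sunlike graph with girth $g$ is a graph obtained from a cycle $\mathbb{C}=v_1\cdots v_gv_1$ by attaching at least one pendant vertex to vertices of the cycle (i.e., it is unicyclic and every vertex not on the cycle is a pendant vertex adjacent to a cycle vertex). -}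

module Defs where

open import Data.Nat using (ℕ; zero; suc; _+_; _∸_; _≤_; _<_)
open import Data.Nat.DivMod using (_/_; _%_)
open import Data.Fin using (Fin; toℕ)
open import Data.Sum using (_⊎_; inj₁; inj₂)
open import Data.Product using (Σ; _×_; ∃; ∃-syntax)
open import Data.Empty using (⊥)
open import Data.List using (List; length)
open import Data.List.Membership.Propositional using (_∈_)
open import Relation.Binary.PropositionalEquality using (_≡_)
open import Function.Definitions using (Injective)
open import Function.Bundles using (_⇔_)

Pendant : {V : Set} → (V → V → Set) → V → Set
Pendant {V} Adj u = Σ V λ w → Adj u w × (∀ w′ → Adj u w′ → w′ ≡ w)

PDominator : {V : Set} → (V → V → Set) → V → Set
PDominator {V} Adj v = Σ V λ u → Adj v u × Pendant Adj u

Dominating : {V : Set} → (V → V → Set) → List V → Set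
Dominating {V} Adj D = ∀ v → v ∈ D ⊎ (Σ V λ u → u ∈ D × Adj v u)

IsDominationNumber : {V : Set} → (V → V → Set) → ℕ → Set
IsDominationNumber {V} Adj d =
  (Σ (List V) λ D → length D ≡ d × Dominating Adj D)
  × (∀ D → Dominating Adj D → d ≤ length D)

-- The cycle C = v_1 ... v_g v_1 has vertices Fin g
-- (index i stands for v_{i+1}); there are m pendant vertices Fin m, and
-- pendant p is attached to the cycle vertex  att p .  Order n = g + m.

SunVertex : ℕ → ℕ → Set
SunVertex g m = Fin g ⊎ Fin m

CycleAdj : (g : ℕ) → Fin g → Fin g → Set
CycleAdj zero    i j = ⊥
CycleAdj (suc g) i j =
  (toℕ j ≡ (suc (toℕ i)) % suc g) ⊎ (toℕ i ≡ (suc (toℕ j)) % suc g)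

SunAdj : (g m : ℕ) → (Fin m → Fin g) → SunVertex g m → SunVertex g m → Set
SunAdj g m att (inj₁ i) (inj₁ j) = CycleAdj g i j
SunAdj g m att (inj₁ i) (inj₂ p) = att p ≡ i
SunAdj g m att (inj₂ p) (inj₁ i) = att p ≡ i
SunAdj g m att (inj₂ p) (inj₂ q) = ⊥

ExactlyPDomOnCycle : (g m : ℕ) → (Fin m → Fin g) → ℕ → Set
ExactlyPDomOnCycle g m att k =
  Σ (Fin k → Fin g) λ f → Injective _≡_ _≡_ f
    × (∀ i → PDominator (SunAdj g m att) (inj₁ i) ⇔ (∃[ j ] f j ≡ i))

ConsecutivePDom : (g m : ℕ) → (Fin m → Fin g) → ℕ → Set
ConsecutivePDom g m att k =
  ∀ i → PDominator (SunAdj g m att) (inj₁ i) ⇔ (toℕ i < k)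

ceil3 : ℕ → ℕ
ceil3 x = (x + 2) / 3

module Submission where

-- Walk around the cycle starting at a p-dominator and take the k p-dominators
-- together with every vertex that is the third one in a row not yet dominated.
-- This dominates G, and each extra vertex uses up three of the g − k other cycle
-- vertices, so γ(G) ≤ k + ⌊(g − k)/3⌋ for every sunlike graph with k p-dominators
-- on its cycle. For G* the bound is attained: a dominating set contains, for each
-- a ≤ k, v_a or a pendant at v_a, and for each block v_{k+3b+1}, v_{k+3b+2},
-- v_{k+3b+3} a vertex of the block, because the middle vertex has no pendant and
-- no neighbour outside the block. Finally ⌈(g − k − 2)/3⌉ = ⌊(g − k)/3⌋.

open import Data.Bool using (Bool; true; false; if_then_else_)
open import Data.Bool.Properties using (T-≡)
open import Data.Empty using (⊥-elim)
open import Data.Fin using (Fin; toℕ; fromℕ<; fromℕ; inject₁; inject≤)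
  renaming (zero to fzero; suc to fsuc; _≟_ to _≟ᶠ_)
open import Data.Fin.Properties
  using (toℕ-injective; toℕ<n; toℕ-fromℕ<; toℕ-fromℕ; toℕ-inject₁; toℕ-inject≤; inject≤-injective; injective⇒≤; any?)
open import Data.List using (List; []; _∷_; _++_; map; tabulate; length; lookup)
open import Data.List.Membership.Propositional using (_∈_)
open import Data.List.Membership.Propositional.Properties using (∈-map⁺; ∈-++⁺ˡ; ∈-++⁺ʳ; ∈-tabulate⁺)
open import Data.List.Properties using (length-++; length-map; length-tabulate)
open import Data.List.Relation.Unary.Any using (here; there; index)
open import Data.List.Relation.Unary.Any.Properties using (lookup-index)
open import Data.Nat using (ℕ; zero; suc; _+_; _*_; _∸_; _≤_; _<_; _≥_; z≤n; s≤s; s≤s⁻¹; z<s; NonZero; _<?_)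
open import Data.Nat.Properties
open import Data.Nat.DivMod
open import Data.Nat.Divisibility using (divides)
open import Data.Nat.Tactic.RingSolver using (solve-∀)
open import Data.Product using (Σ-syntax; _×_; _,_; proj₁; proj₂; ∃-syntax)
open import Data.Sum using (_⊎_; inj₁; inj₂)
open import Data.Sum.Properties using (inj₁-injective)
open import Function using (_∘_)
open import Function.Bundles using (_⇔_; mk⇔; Equivalence)
open import Function.Definitions using (Injective)
open import Relation.Nullary using (¬_; yes; no)
open import Relation.Nullary.Decidable using (isYes; toWitness; fromWitness)
open import Relation.Binary.PropositionalEquality

open import Defs

ceil3[m∸2]≡m/3 : ∀ m → ceil3 (m ∸ 2) ≡ m / 3
ceil3[m∸2]≡m/3 zero = refl
ceil3[m∸2]≡m/3 (suc zero) = refl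
ceil3[m∸2]≡m/3 (suc (suc m)) = cong (_/ 3) (+-comm m 2)

[r+m*3]/3≡m : ∀ {r} m → r < 3 → (r + m * 3) / 3 ≡ m
[r+m*3]/3≡m {r} m r<3 = begin
  (r + m * 3) / 3   ≡⟨ +-distrib-/-∣ʳ r (divides m refl) ⟩
  r / 3 + m * 3 / 3 ≡⟨ cong₂ _+_ (m<n⇒m/n≡0 r<3) (m*n/n≡m m 3) ⟩
  m                 ∎
  where open ≡-Reasoning

m<n/3⇒3+m*3≤n : ∀ {m n} → m < n / 3 → 3 + m * 3 ≤ n
m<n/3⇒3+m*3≤n {m} {n} m<n/3 = ≤-trans (*-monoˡ-≤ 3 m<n/3) (m/n*n≤m n 3)

3*m+n≤o⇒m≤[o∸n]/3 : ∀ {m n o} → 3 * m + n ≤ o → m ≤ (o ∸ n) / 3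
3*m+n≤o⇒m≤[o∸n]/3 {m} {n} {o} le =
  subst (_≤ (o ∸ n) / 3) (m*n/n≡m m 3) (/-monoˡ-≤ 3 (m+n≤o⇒m≤o∸n (m * 3) m*3+n≤o))
  where
  m*3+n≤o : m * 3 + n ≤ o
  m*3+n≤o = subst (λ x → x + n ≤ o) (*-comm 3 m) le

injective-members⇒≤ : ∀ {A : Set} {k} (xs : List A) (g : Fin k → A) →
                      Injective _≡_ _≡_ g → (∀ j → g j ∈ xs) → k ≤ length xs
injective-members⇒≤ xs g g-inj g∈xs = injective⇒≤ {f = index ∘ g∈xs} index-inj
  where
  index-inj : ∀ {j j′} → index (g∈xs j) ≡ index (g∈xs j′) → j ≡ j′
  index-inj {j} {j′} e = g-inj (begin
    g j                          ≡⟨ lookup-index (g∈xs j) ⟩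
    lookup xs (index (g∈xs j))   ≡⟨ cong (lookup xs) e ⟩
    lookup xs (index (g∈xs j′))  ≡⟨ lookup-index (g∈xs j′) ⟨
    g j′                         ∎)
    where open ≡-Reasoning

bit : Bool → ℕ
bit true = 1
bit false = 0

positions : (ℕ → Bool) → ℕ → List ℕ
positions p zero = []
positions p (suc n) = if p n then n ∷ positions p n else positions p n

count : (ℕ → Bool) → ℕ → ℕ
count p n = length (positions p n)

count-suc : ∀ p n → count p (suc n) ≡ bit (p n) + count p n
count-suc p n with p n
... | true = refl
... | false = refl

∈-positions : ∀ p {n t} → p t ≡ true → t < n → t ∈ positions p n
∈-positions p {suc n} {t} pt t<1+n with m≤n⇒m<n∨m≡n (s≤s⁻¹ t<1+n)
... | inj₂ refl rewrite pt = here refl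
... | inj₁ t<n with p n
...   | true = there (∈-positions p pt t<n)
...   | false = ∈-positions p pt t<n

data Run : Set where
  run₀ run₁ run₂ : Run

runLength : Run → ℕ
runLength run₀ = 0
runLength run₁ = 1
runLength run₂ = 2

step : Bool → Run → Run
step true  _    = run₀
step false run₀ = run₁
step false run₁ = run₂
step false run₂ = run₀

choose : Bool → Run → Bool
choose false run₂ = true
choose _     _    = false

-- A chosen position pays for itself and the two unmarked positions before it.
step-cost : ∀ β r → 3 * bit (choose β r) + bit β + runLength (step β r) ≤ suc (runLength r)
step-cost true  r    = s≤s z≤n
step-cost false run₀ = ≤-refl
step-cost false run₁ = ≤-refl
step-cost false run₂ = ≤-refl

step≡run₀ : ∀ β r → step β r ≡ run₀ → β ≡ true ⊎ choose β r ≡ true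
step≡run₀ true  r    _ = inj₁ refl
step≡run₀ false run₂ _ = inj₂ refl

choose-run₂ : ∀ β → β ≡ true ⊎ choose β run₂ ≡ true
choose-run₂ true  = inj₁ refl
choose-run₂ false = inj₂ refl

-- Greedy marking of positions 0, 1, 2, … of a cycle cut open at a p-dominator
-- (position 0): besides the positions where b holds, choose every position that
-- is preceded by two consecutive unmarked positions.
module Greedy (b : ℕ → Bool) where

  run : ℕ → Run
  run zero    = run₀
  run (suc t) = step (b (suc t)) (run t)

  chosen : ℕ → Bool
  chosen zero    = false
  chosen (suc t) = choose (b (suc t)) (run t)

  Marked : ℕ → Set
  Marked t = b t ≡ true ⊎ chosen t ≡ true

  chosen⇒¬b : ∀ t → chosen t ≡ true → b t ≡ false
  chosen⇒¬b (suc t) _ with b (suc t)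
  ... | false = refl

  run≡run₀⇒Marked : b 0 ≡ true → ∀ t → run t ≡ run₀ → Marked t
  run≡run₀⇒Marked b0 zero    _ = inj₁ b0
  run≡run₀⇒Marked b0 (suc t) e = step≡run₀ (b (suc t)) (run t) e

  marked-neighbour : b 0 ≡ true → ∀ t →
    Marked t ⊎ (∃[ t′ ] suc t′ ≡ t × Marked t′) ⊎ Marked (suc t)
  marked-neighbour b0 zero = inj₁ (inj₁ b0)
  marked-neighbour b0 (suc t) with b (suc t) | run t in r
  ... | true  | _    = inj₁ (inj₁ refl)
  ... | false | run₀ = inj₂ (inj₁ (t , refl , run≡run₀⇒Marked b0 t r))
  ... | false | run₁ = inj₂ (inj₂ (choose-run₂ (b (2 + t))))
  ... | false | run₂ = inj₁ (inj₂ refl)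

  cost-invariant : ∀ t → 3 * count chosen (suc t) + count b (suc t) + runLength (run t) ≤ suc t
  cost-invariant zero with b 0
  ... | true  = ≤-refl
  ... | false = z≤n
  cost-invariant (suc t) = begin
    3 * count chosen (2 + t) + count b (2 + t) + runLength r′
      ≡⟨ cong₂ (λ x y → 3 * x + y + runLength r′) (count-suc chosen (suc t)) (count-suc b (suc t)) ⟩
    3 * (bit c + C) + (bit β + B) + runLength r′
      ≡⟨ rearrange (bit c) C (bit β) B (runLength r′) ⟩
    (3 * bit c + bit β + runLength r′) + (3 * C + B)
      ≤⟨ +-monoˡ-≤ (3 * C + B) (step-cost β (run t)) ⟩
    suc (runLength (run t)) + (3 * C + B)
      ≡⟨ cong suc (+-comm (runLength (run t)) (3 * C + B)) ⟩
    suc (3 * C + B + runLength (run t))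
      ≤⟨ s≤s (cost-invariant t) ⟩
    suc (suc t) ∎
    where
    open ≤-Reasoning
    β c : Bool
    β = b (suc t)
    c = chosen (suc t)
    r′ : Run
    r′ = run (suc t)
    C B : ℕ
    C = count chosen (suc t)
    B = count b (suc t)
    rearrange : ∀ c C β B w → 3 * (c + C) + (β + B) + w ≡ (3 * c + β + w) + (3 * C + B)
    rearrange = solve-∀

  count-bound : ∀ n → 3 * count chosen n + count b n ≤ n
  count-bound zero    = z≤n
  count-bound (suc t) = ≤-trans (m≤m+n _ (runLength (run t))) (cost-invariant t)

[m+n%d]%d≡[m+n]%d : ∀ m n d .{{_ : NonZero d}} → (m + n % d) % d ≡ (m + n) % d
[m+n%d]%d≡[m+n]%d m n d = begin
  (m + n % d) % d         ≡⟨ %-distribˡ-+ m (n % d) d ⟩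
  (m % d + n % d % d) % d ≡⟨ cong (λ x → (m % d + x) % d) (m%n%n≡m%n n d) ⟩
  (m % d + n % d) % d     ≡⟨ %-distribˡ-+ m n d ⟨
  (m + n) % d             ∎
  where open ≡-Reasoning

suc%-cases : ∀ {a n} .{{_ : NonZero n}} → a < n → suc a % n ≡ suc a ⊎ suc a ≡ n
suc%-cases a<n with m≤n⇒m<n∨m≡n a<n
... | inj₁ 1+a<n = inj₁ (m<n⇒m%n≡m 1+a<n)
... | inj₂ 1+a≡n = inj₂ 1+a≡n

[2+m]%n≢m : ∀ {m n} .{{_ : NonZero n}} → 3 ≤ n → suc m < n → suc (suc m) % n ≢ m
[2+m]%n≢m {m} {n} n≥3 1+m<n eq with suc%-cases 1+m<n
... | inj₁ no-wrap = <⇒≢ (m<n+m m z<s) (trans (sym eq) no-wrap)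
... | inj₂ wrap    = <⇒≢ n≥3 (trans (cong (2 +_) (sym m≡0)) wrap)
  where
  m≡0 : m ≡ 0
  m≡0 = trans (sym eq) (trans (cong (_% n) wrap) (n%n≡0 n))

CycleAdj-interior : ∀ {h} {i j : Fin (suc h)} → 0 < toℕ i → suc (toℕ i) < suc h →
                    CycleAdj (suc h) i j → toℕ j ≡ suc (toℕ i) ⊎ suc (toℕ j) ≡ toℕ i
CycleAdj-interior _ 1+i<G (inj₁ j≡) = inj₁ (trans j≡ (m<n⇒m%n≡m 1+i<G))
CycleAdj-interior {h} {i} {j} 0<i _ (inj₂ i≡) with suc%-cases {n = suc h} (toℕ<n j)
... | inj₁ e = inj₂ (sym (trans i≡ e))
... | inj₂ e = ⊥-elim (<⇒≢ 0<i (sym (trans i≡ (trans (cong (_% suc h) e) (n%n≡0 (suc h))))))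

module Sunlike {h m : ℕ} (att : Fin m → Fin (suc h)) where

  Adj : SunVertex (suc h) m → SunVertex (suc h) m → Set
  Adj = SunAdj (suc h) m att

  pendant-vertex : ∀ p → Pendant Adj (inj₂ p)
  pendant-vertex p = inj₁ (att p) , refl , λ { (inj₁ i) e → cong inj₁ (sym e) ; (inj₂ q) () }

  attachment-pdominator : ∀ p → PDominator Adj (inj₁ (att p))
  attachment-pdominator p = inj₂ p , refl , pendant-vertex p

  successor : Fin (suc h) → Fin (suc h)
  successor i = fromℕ< (m%n<n (suc (toℕ i)) (suc h))

  predecessor : Fin (suc h) → Fin (suc h)
  predecessor fzero    = fromℕ h
  predecessor (fsuc j) = inject₁ j

  toℕ-successor : ∀ i → toℕ (successor i) ≡ suc (toℕ i) % suc h
  toℕ-successor i = toℕ-fromℕ< _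

  toℕ-predecessor : ∀ i → toℕ i ≡ suc (toℕ (predecessor i)) % suc h
  toℕ-predecessor fzero    = sym (trans (cong (λ x → suc x % suc h) (toℕ-fromℕ h)) (n%n≡0 (suc h)))
  toℕ-predecessor (fsuc j) =
    sym (trans (cong (λ x → suc x % suc h) (toℕ-inject₁ j)) (m<n⇒m%n≡m (toℕ<n (fsuc j))))

  successor≢predecessor : 3 ≤ suc h → ∀ i → toℕ (successor i) ≢ toℕ (predecessor i)
  successor≢predecessor g≥3 fzero e = <⇒≢ (s≤s⁻¹ g≥3) (begin
    1                     ≡⟨ m<n⇒m%n≡m (≤-trans (s≤s (s≤s z≤n)) g≥3) ⟨
    1 % suc h             ≡⟨ toℕ-successor fzero ⟨
    toℕ (successor fzero) ≡⟨ e ⟩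
    toℕ (fromℕ h)         ≡⟨ toℕ-fromℕ h ⟩
    h                     ∎)
    where open ≡-Reasoning
  successor≢predecessor g≥3 (fsuc j) e = [2+m]%n≢m g≥3 (toℕ<n (fsuc j)) (begin
    suc (suc (toℕ j)) % suc h ≡⟨ toℕ-successor (fsuc j) ⟨
    toℕ (successor (fsuc j))  ≡⟨ e ⟩
    toℕ (inject₁ j)           ≡⟨ toℕ-inject₁ j ⟩
    toℕ j                     ∎)
    where open ≡-Reasoning

  cycle-vertex-not-pendant : 3 ≤ suc h → ∀ i → ¬ Pendant Adj (inj₁ i)
  cycle-vertex-not-pendant g≥3 i (w , _ , unique) =
    successor≢predecessor g≥3 i (cong toℕ (inj₁-injective successor≡predecessor))
    where
    successor≡predecessor : inj₁ (successor i) ≡ inj₁ (predecessor i)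
    successor≡predecessor =
      trans (unique _ (inj₁ (toℕ-successor i))) (sym (unique _ (inj₂ (toℕ-predecessor i))))

  pdominator⇒attached : 3 ≤ suc h → ∀ {i} → PDominator Adj (inj₁ i) → ∃[ p ] att p ≡ i
  pdominator⇒attached g≥3 (inj₁ j , _ , pendant) = ⊥-elim (cycle-vertex-not-pendant g≥3 j pendant)
  pdominator⇒attached g≥3 (inj₂ p , att≡ , _)    = p , att≡

module UpperBound {h m k′ : ℕ} {att : Fin m → Fin (suc h)}
                  (f : Fin (suc k′) → Fin (suc h)) (f-inj : Injective _≡_ _≡_ f)
                  (f-pd : ∀ i → PDominator (SunAdj (suc h) m att) (inj₁ i) ⇔ (∃[ j ] f j ≡ i))
                  where

  open Sunlike att

  private
    G k s : ℕ
    G = suc h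
    k = suc k′
    s = toℕ (f fzero)

  vertexAt : ℕ → Fin G
  vertexAt t = fromℕ< (m%n<n (s + t) G)

  toℕ-vertexAt : ∀ t → toℕ (vertexAt t) ≡ (s + t) % G
  toℕ-vertexAt t = toℕ-fromℕ< _

  toℕ-vertexAt-suc : ∀ t → toℕ (vertexAt (suc t)) ≡ suc (toℕ (vertexAt t)) % G
  toℕ-vertexAt-suc t = begin
    toℕ (vertexAt (suc t))     ≡⟨ toℕ-vertexAt (suc t) ⟩
    (s + suc t) % G            ≡⟨ cong (_% G) (+-suc s t) ⟩
    (1 + (s + t)) % G          ≡⟨ [m+n%d]%d≡[m+n]%d 1 (s + t) G ⟨
    suc ((s + t) % G) % G      ≡⟨ cong (λ x → suc x % G) (toℕ-vertexAt t) ⟨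
    suc (toℕ (vertexAt t)) % G ∎
    where open ≡-Reasoning

  vertexAt-0 : vertexAt 0 ≡ f fzero
  vertexAt-0 = toℕ-injective (begin
    toℕ (vertexAt 0) ≡⟨ toℕ-vertexAt 0 ⟩
    (s + 0) % G      ≡⟨ cong (_% G) (+-identityʳ s) ⟩
    s % G            ≡⟨ m<n⇒m%n≡m (toℕ<n (f fzero)) ⟩
    s                ∎)
    where open ≡-Reasoning

  vertexAt-G : vertexAt G ≡ f fzero
  vertexAt-G = trans (toℕ-injective (begin
    toℕ (vertexAt G) ≡⟨ toℕ-vertexAt G ⟩
    (s + G) % G      ≡⟨ [m+n]%n≡m%n s G ⟩
    s % G            ≡⟨ cong (_% G) (+-identityʳ s) ⟨
    (s + 0) % G      ≡⟨ toℕ-vertexAt 0 ⟨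
    toℕ (vertexAt 0) ∎)) vertexAt-0
    where open ≡-Reasoning

  stepsTo : Fin G → ℕ
  stepsTo i = (toℕ i + (G ∸ s)) % G

  stepsTo<G : ∀ i → stepsTo i < G
  stepsTo<G i = m%n<n (toℕ i + (G ∸ s)) G

  vertexAt-stepsTo : ∀ i → vertexAt (stepsTo i) ≡ i
  vertexAt-stepsTo i = toℕ-injective (begin
    toℕ (vertexAt (stepsTo i))  ≡⟨ toℕ-vertexAt (stepsTo i) ⟩
    (s + stepsTo i) % G         ≡⟨ [m+n%d]%d≡[m+n]%d s (toℕ i + (G ∸ s)) G ⟩
    (s + (toℕ i + (G ∸ s))) % G ≡⟨ cong (_% G) (x+[y+z]≡y+[x+z] s (toℕ i) (G ∸ s)) ⟩
    (toℕ i + (s + (G ∸ s))) % G ≡⟨ cong (λ x → (toℕ i + x) % G) (m+[n∸m]≡n (<⇒≤ (toℕ<n (f fzero)))) ⟩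
    (toℕ i + G) % G             ≡⟨ [m+n]%n≡m%n (toℕ i) G ⟩
    toℕ i % G                   ≡⟨ m<n⇒m%n≡m (toℕ<n i) ⟩
    toℕ i                       ∎)
    where
    open ≡-Reasoning
    x+[y+z]≡y+[x+z] : ∀ x y z → x + (y + z) ≡ y + (x + z)
    x+[y+z]≡y+[x+z] = solve-∀

  isPD : ℕ → Bool
  isPD t = isYes (any? λ j → f j ≟ᶠ vertexAt t)

  isPD-sound : ∀ {t} → isPD t ≡ true → ∃[ j ] f j ≡ vertexAt t
  isPD-sound e = toWitness (Equivalence.from T-≡ e)

  isPD-complete : ∀ {t} → ∃[ j ] f j ≡ vertexAt t → isPD t ≡ true
  isPD-complete p = Equivalence.to T-≡ (fromWitness p)

  isPD-0 : isPD 0 ≡ true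
  isPD-0 = isPD-complete (fzero , sym vertexAt-0)

  open Greedy isPD

  D : List (SunVertex G m)
  D = tabulate (inj₁ ∘ f) ++ map (inj₁ ∘ vertexAt) (positions chosen G)

  Dominated : SunVertex G m → Set
  Dominated v = v ∈ D ⊎ (Σ[ u ∈ SunVertex G m ] u ∈ D × Adj v u)

  f∈D : ∀ j → inj₁ (f j) ∈ D
  f∈D j = ∈-++⁺ˡ (∈-tabulate⁺ {f = inj₁ ∘ f} j)

  pdominator∈D : ∀ {i} → PDominator Adj (inj₁ i) → inj₁ i ∈ D
  pdominator∈D {i} pd with Equivalence.to (f-pd i) pd
  ... | j , refl = f∈D j

  -- Position G is position 0 again, which is not chosen.
  marked∈D : ∀ {u} → u ≤ G → Marked u → inj₁ (vertexAt u) ∈ D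
  marked∈D _ (inj₁ pd) with isPD-sound pd
  ... | j , e = subst (λ x → inj₁ x ∈ D) e (f∈D j)
  marked∈D {u} u≤G (inj₂ ch) with m≤n⇒m<n∨m≡n u≤G
  ... | inj₁ u<G = ∈-++⁺ʳ _ (∈-map⁺ (inj₁ ∘ vertexAt) (∈-positions chosen ch u<G))
  ... | inj₂ refl with () ← trans (sym (chosen⇒¬b G ch)) (isPD-complete (fzero , sym vertexAt-G))

  vertexAt-dominated : ∀ t → t < G → Dominated (inj₁ (vertexAt t))
  vertexAt-dominated t t<G with marked-neighbour isPD-0 t
  ... | inj₁ marked = inj₁ (marked∈D (<⇒≤ t<G) marked)
  ... | inj₂ (inj₁ (t′ , refl , marked)) =
    inj₂ (inj₁ (vertexAt t′) , marked∈D (<⇒≤ (<-trans (n<1+n t′) t<G)) marked , inj₂ (toℕ-vertexAt-suc t′))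
  ... | inj₂ (inj₂ marked) =
    inj₂ (inj₁ (vertexAt (suc t)) , marked∈D t<G marked , inj₁ (toℕ-vertexAt-suc t))

  D-dominating : Dominating Adj D
  D-dominating (inj₁ i) =
    subst (Dominated ∘ inj₁) (vertexAt-stepsTo i) (vertexAt-dominated (stepsTo i) (stepsTo<G i))
  D-dominating (inj₂ p) = inj₂ (inj₁ (att p) , pdominator∈D (attachment-pdominator p) , refl)

  k≤count-isPD : k ≤ count isPD G
  k≤count-isPD = injective-members⇒≤ (positions isPD G) (stepsTo ∘ f) stepsTo∘f-inj stepsTo∘f∈
    where
    stepsTo∘f-inj : Injective _≡_ _≡_ (stepsTo ∘ f)
    stepsTo∘f-inj {j} {j′} e =
      f-inj (trans (sym (vertexAt-stepsTo (f j))) (trans (cong vertexAt e) (vertexAt-stepsTo (f j′))))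
    stepsTo∘f∈ : ∀ j → stepsTo (f j) ∈ positions isPD G
    stepsTo∘f∈ j = ∈-positions isPD (isPD-complete (j , sym (vertexAt-stepsTo (f j)))) (stepsTo<G (f j))

  length-D : length D ≡ k + count chosen G
  length-D = trans (length-++ (tabulate (inj₁ ∘ f)))
                   (cong₂ _+_ (length-tabulate (inj₁ ∘ f)) (length-map (inj₁ ∘ vertexAt) (positions chosen G)))

  length-D≤ : length D ≤ k + (G ∸ k) / 3
  length-D≤ = subst (_≤ k + (G ∸ k) / 3) (sym length-D) (+-monoʳ-≤ k (3*m+n≤o⇒m≤[o∸n]/3 cost))
    where
    cost : 3 * count chosen G + k ≤ G
    cost = ≤-trans (+-monoʳ-≤ (3 * count chosen G) k≤count-isPD) (count-bound G)

-- Class a < k consists of v_a and its pendants, class k + b of the cycle positions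
-- k + 3b, k + 3b + 1 and k + 3b + 2.
module LowerBound {h m k : ℕ} {att : Fin m → Fin (suc h)} (g≥3 : 3 ≤ suc h) (k≤g : k ≤ suc h)
                  (consecutive : ConsecutivePDom (suc h) m att k)
                  {D : List (SunVertex (suc h) m)} (D-dominating : Dominating (SunAdj (suc h) m att) D)
                  where

  open Sunlike att

  private
    G : ℕ
    G = suc h

  classOf : ℕ → ℕ
  classOf x with x <? k
  ... | yes _ = x
  ... | no  _ = (x ∸ k) / 3 + k

  class : SunVertex G m → ℕ
  class (inj₁ i) = classOf (toℕ i)
  class (inj₂ p) = toℕ (att p)

  classOf-< : ∀ {x} → x < k → classOf x ≡ x
  classOf-< {x} x<k with x <? k
  ... | yes _   = refl
  ... | no  x≮k = ⊥-elim (x≮k x<k)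

  classOf-block : ∀ b {r} → r < 3 → classOf (r + b * 3 + k) ≡ b + k
  classOf-block b {r} r<3 with r + b * 3 + k <? k
  ... | yes lt = ⊥-elim (<⇒≱ lt (m≤n+m k (r + b * 3)))
  ... | no  _  = cong (_+ k) (trans (cong (_/ 3) (m+n∸n≡m (r + b * 3) k)) ([r+m*3]/3≡m b r<3))

  MeetsClass : ℕ → Set
  MeetsClass a = Σ[ x ∈ SunVertex G m ] x ∈ D × class x ≡ a

  attachment<k : ∀ p → toℕ (att p) < k
  attachment<k p = Equivalence.to (consecutive (att p)) (attachment-pdominator p)

  pendant-class : ∀ p → MeetsClass (toℕ (att p))
  pendant-class p with D-dominating (inj₂ p)
  ... | inj₁ p∈D                   = inj₂ p , p∈D , refl
  ... | inj₂ (inj₁ _ , v∈D , refl) = inj₁ (att p) , v∈D , classOf-< (attachment<k p)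
  ... | inj₂ (inj₂ _ , _ , ())

  prefix-class : ∀ {a} → a < k → MeetsClass a
  prefix-class {a} a<k with pdominator⇒attached g≥3 (Equivalence.from (consecutive v) v<k)
    where
    v : Fin G
    v = fromℕ< (≤-trans a<k k≤g)
    v<k : toℕ v < k
    v<k = subst (_< k) (sym (toℕ-fromℕ< _)) a<k
  ... | p , att≡v = subst MeetsClass (trans (cong toℕ att≡v) (toℕ-fromℕ< _)) (pendant-class p)

  middle-class : ∀ b (w : Fin G) → toℕ w ≡ 1 + b * 3 + k → 2 + b * 3 + k < G → MeetsClass (b + k)
  middle-class b w toℕ-w 2+b*3+k<G with D-dominating (inj₁ w)
  ... | inj₁ w∈D = inj₁ w , w∈D , trans (cong classOf toℕ-w) (classOf-block b (s≤s (s≤s z≤n)))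
  ... | inj₂ (inj₂ q , _ , att≡w) = ⊥-elim (<⇒≱ (attachment<k q) (subst (k ≤_) toℕ-att (m≤n+m k _)))
    where
    toℕ-att : 1 + b * 3 + k ≡ toℕ (att q)
    toℕ-att = trans (sym toℕ-w) (cong toℕ (sym att≡w))
  ... | inj₂ (inj₁ j , j∈D , w~j) with CycleAdj-interior 0<w 1+w<G w~j
    where
    0<w : 0 < toℕ w
    0<w = subst (0 <_) (sym toℕ-w) z<s
    1+w<G : suc (toℕ w) < G
    1+w<G = subst (λ x → suc x < G) (sym toℕ-w) 2+b*3+k<G
  ...   | inj₁ j≡ = inj₁ j , j∈D , trans (cong classOf (trans j≡ (cong suc toℕ-w)))
                                         (classOf-block b (s≤s (s≤s (s≤s z≤n))))
  ...   | inj₂ j≡ = inj₁ j , j∈D , trans (cong classOf (suc-injective (trans j≡ toℕ-w)))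
                                         (classOf-block b (s≤s z≤n))

  block-class : ∀ b → 3 + b * 3 + k ≤ G → MeetsClass (b + k)
  block-class b block≤G =
    middle-class b (fromℕ< {1 + b * 3 + k} (<⇒≤ block≤G)) (toℕ-fromℕ< (<⇒≤ block≤G)) block≤G

  every-class : ∀ a → a < k + (G ∸ k) / 3 → MeetsClass a
  every-class a a<bound with a <? k
  ... | yes a<k = prefix-class a<k
  ... | no  a≮k = subst MeetsClass (m∸n+n≡m k≤a) (block-class (a ∸ k) block≤G)
    where
    k≤a : k ≤ a
    k≤a = ≮⇒≥ a≮k
    a∸k<bound : a ∸ k < (G ∸ k) / 3
    a∸k<bound = subst (a ∸ k <_) (m+n∸m≡n k ((G ∸ k) / 3)) (∸-monoˡ-< a<bound k≤a)
    block≤G : 3 + (a ∸ k) * 3 + k ≤ G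
    block≤G = m≤o∸n⇒m+n≤o (3 + (a ∸ k) * 3) k≤g (m<n/3⇒3+m*3≤n a∸k<bound)

  bound≤length-D : k + (G ∸ k) / 3 ≤ length D
  bound≤length-D = injective-members⇒≤ D representative representative-inj (proj₁ ∘ proj₂ ∘ meets)
    where
    meets : ∀ a → MeetsClass (toℕ a)
    meets a = every-class (toℕ a) (toℕ<n a)
    representative : Fin (k + (G ∸ k) / 3) → SunVertex G m
    representative = proj₁ ∘ meets
    representative-inj : Injective _≡_ _≡_ representative
    representative-inj {a} {a′} e =
      toℕ-injective (trans (sym (proj₂ (proj₂ (meets a)))) (trans (cong class e) (proj₂ (proj₂ (meets a′)))))

exactlyPDom⇒γ≤ : ∀ {h m k′ d} {att : Fin m → Fin (suc h)} →
  ExactlyPDomOnCycle (suc h) m att (suc k′) → IsDominationNumber (SunAdj (suc h) m att) d →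
  d ≤ suc k′ + (suc h ∸ suc k′) / 3
exactlyPDom⇒γ≤ (f , f-inj , f-pd) (_ , minimal) = ≤-trans (minimal D D-dominating) length-D≤
  where open UpperBound f f-inj f-pd

consecutivePDom⇒γ≥ : ∀ {h m k d} {att : Fin m → Fin (suc h)} → 3 ≤ suc h → k ≤ suc h →
  ConsecutivePDom (suc h) m att k → IsDominationNumber (SunAdj (suc h) m att) d →
  k + (suc h ∸ k) / 3 ≤ d
consecutivePDom⇒γ≥ g≥3 k≤g consecutive ((D , |D|≡d , D-dominating) , _) =
  subst (_ ≤_) |D|≡d (LowerBound.bound≤length-D g≥3 k≤g consecutive D-dominating)

consecutive⇒exactlyPDom : ∀ {g m k} {att : Fin m → Fin g} → k ≤ g →
  ConsecutivePDom g m att k → ExactlyPDomOnCycle g m att k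
consecutive⇒exactlyPDom {k = k} k≤g consecutive = embed , embed-inj , pdominator⇔embedded
  where
  embed : Fin k → Fin _
  embed j = inject≤ j k≤g
  embed-inj : Injective _≡_ _≡_ embed
  embed-inj {j} {j′} = inject≤-injective k≤g k≤g j j′
  pdominator⇔embedded : ∀ i → PDominator _ (inj₁ i) ⇔ (∃[ j ] embed j ≡ i)
  pdominator⇔embedded i = mk⇔
    (λ pd → let i<k = Equivalence.to (consecutive i) pd in
            fromℕ< i<k , toℕ-injective (trans (toℕ-inject≤ _ k≤g) (toℕ-fromℕ< i<k)))
    (λ { (j , refl) → Equivalence.from (consecutive _) (subst (_< k) (sym (toℕ-inject≤ j k≤g)) (toℕ<n j)) })

lemma3p1 : (n g k m m* : ℕ) → g ≥ 3 → k ≥ 1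
    → (att : Fin m → Fin g) → g + m ≡ n → m ≥ 1
    → ExactlyPDomOnCycle g m att k
    → (att* : Fin m* → Fin g) → g + m* ≡ n → m* ≥ 1
    → ConsecutivePDom g m* att* k
    → (d d* : ℕ)
    → IsDominationNumber (SunAdj g m att) d
    → IsDominationNumber (SunAdj g m* att*) d*
    → d ≤ d* × d* ≡ k + ceil3 (g ∸ k ∸ 2)
lemma3p1 _ (suc h) (suc k′) _ _ g≥3@(s≤s _) (s≤s z≤n) _ _ _ exactly _ _ _ consecutive d d* γ γ* =
  ≤-trans (exactlyPDom⇒γ≤ exactly γ) bound≤d* ,
  trans (≤-antisym d*≤bound bound≤d*) (cong (suc k′ +_) (sym (ceil3[m∸2]≡m/3 (suc h ∸ suc k′))))
  where
  k≤g : suc k′ ≤ suc h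
  k≤g = injective⇒≤ (proj₁ (proj₂ exactly))
  bound≤d* : suc k′ + (suc h ∸ suc k′) / 3 ≤ d*
  bound≤d* = consecutivePDom⇒γ≥ g≥3 k≤g consecutive γ*
  d*≤bound : d* ≤ suc k′ + (suc h ∸ suc k′) / 3
  d*≤bound = exactlyPDom⇒γ≤ (consecutive⇒exactlyPDom k≤g consecutive) γ*
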